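{- Let $\Pi$ be a compatible partition system on $X$, let $\pi\in\Pi$, and let $E_\pi$ be a subset of edges of $\mathcal{T}_\Pi=(T;\phi)$ that displays $\pi$. Then: (i) if $V_1,\dots,V_k$ ($k\ge1$) are the vertex sets of the components of the forest obtained from $T$ by deleting the edges of $E_\pi$, then $k=|\pi|+1$ and $\{\phi^{ -1}(V_1),\dots,\phi^{ -1}(V_k)\}=\pi\cup\{\emptyset\}$; (ii) for every pair of labelled vertices $u,v$ of $\mathcal{T}_\Pi$, the path joining $u$ and $v$ contains exactly $0$ or $2$ edges of $E_\pi$.
   Context: $X$ is a finite set with $|X|\ge 2$. A partition of $X$ is a set of $t\ge 2$ pairwise disjoint non-empty subsets (parts) whose union is $X$; an $X$-split is a partition with two parts, written $A|(X-A)$. A partition system is a finite multiset of partitions of $X$; $\Sigma_\Pi=\biguplus_{\pi\in\Pi}\biguplus_{A\in\pi}\{A|(X-A)\}$ (multiset union). A split multiset is compatible if for any two of its splits $A_1|B_1,A_2|B_2$ one of $A_1\cap A_2,A_1\cap B_2,B_1\cap A_2,B_1\cap B_2$ is empty; $\Pi$ is compatible if $\Sigma_\Pi$ is. A weak $X$-tree $(T;\phi)$ is a tree $T$ with $\phi:X\to V(T)$ such that every leaf lies in $\phi(X)$; vertices in $\phi(X)$ are labelled. For an edge $e$, $\sigma_e=A|(X-A)$ with $A=\phi^{ -1}(W)$, $W$ the vertex set of a component of $T-e$; $\Sigma(\mathcal{T})=\biguplus_e\{\sigma_e\}$. For compatible $\Pi$, $\mathcal{T}_\Pi$ is the weak $X$-tree,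 unique up to isomorphism, with $\Sigma(\mathcal{T}_\Pi)=\Sigma_\Pi$. A subset $E_\pi$ of edges of a weak $X$-tree displays a partition $\pi$ if there is a bijection $\xi:\pi\to E_\pi$ such that $\sigma_{\xi(A)}=A|(X-A)$ for every $A\in\pi$. -}

module Defs where

open import Data.Nat using (ℕ; suc; _≤_)
open import Data.Fin using (Fin)
open import Data.Fin.Subset using (Subset; _∈_; _∉_; _∩_; ∁; Empty; Nonempty)
open import Data.Fin.Subset.Properties using (_∈?_)
open import Data.List using (List; []; _∷_; length; lookup; filter)
open import Data.List.Relation.Unary.All using (All)
open import Data.List.Relation.Unary.Unique.Propositional using (Unique)
open import Data.Product using (Σ; ∃; _×_; _,_; proj₁; proj₂)
open import Data.Sum using (_⊎_)
open import Data.Unit using (⊤)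
open import Relation.Binary.PropositionalEquality using (_≡_; _≢_)
open import Relation.Nullary using (¬_)
open import Function.Bundles using (_⤖_; Bijection)

-- X is represented by Fin n.  Subsets of X are Data.Fin.Subset.
-- A split A|(X-A) is represented by (either of) its sides; we only ever
-- speak about "the split A|(X-A)" for a given subset A.

record IsPartition {n : ℕ} (π : List (Subset n)) : Set where
  field
    atLeastTwo : 2 ≤ length π
    nonempty   : ∀ i → Nonempty (lookup π i)
    disjoint   : ∀ i j → i ≢ j → Empty (lookup π i ∩ lookup π j)
    covers     : ∀ (x : Fin n) → ∃ λ i → x ∈ lookup π i

-- A partition system: a finite multiset (list) of partitions.
PartitionSystem : ℕ → Set
PartitionSystem n = List (List (Subset n))

IsPartitionSystem : ∀ {n} → PartitionSystem n → Set
IsPartitionSystem Π = ∀ i → IsPartition (lookup Π i)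

-- Index set of the multiset Σ_Π : one entry A|(X-A) per (π ∈ Π, A ∈ π).
SplitIx : ∀ {n} → PartitionSystem n → Set
SplitIx Π = Σ (Fin (length Π)) λ i → Fin (length (lookup Π i))

splitSide : ∀ {n} (Π : PartitionSystem n) → SplitIx Π → Subset n
splitSide Π (i , j) = lookup (lookup Π i) j

CompatibleSplits : ∀ {n} → Subset n → Subset n → Set
CompatibleSplits A₁ A₂ =
  Empty (A₁ ∩ A₂) ⊎ Empty (A₁ ∩ ∁ A₂) ⊎ Empty (∁ A₁ ∩ A₂) ⊎ Empty (∁ A₁ ∩ ∁ A₂)

Compatible : ∀ {n} → PartitionSystem n → Set
Compatible Π = ∀ (a b : SplitIx Π) → CompatibleSplits (splitSide Π a) (splitSide Π b)

record Graph : Set where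
  field
    nv   : ℕ
    ne   : ℕ
    ends : Fin ne → Fin nv × Fin nv
open Graph public

Adj : (G : Graph) → Fin (ne G) → Fin (nv G) → Fin (nv G) → Set
Adj G e u w = ends G e ≡ (u , w) ⊎ ends G e ≡ (w , u)

Incident : (G : Graph) → Fin (ne G) → Fin (nv G) → Set
Incident G e v = proj₁ (ends G e) ≡ v ⊎ proj₂ (ends G e) ≡ v

data Walk (G : Graph) : Fin (nv G) → Fin (nv G) → Set where
  []   : ∀ {u} → Walk G u u
  step : ∀ {u w v} (e : Fin (ne G)) → Adj G e u w → Walk G w v → Walk G u v

walkEdges : ∀ {G u v} → Walk G u v → List (Fin (ne G))
walkEdges []           = []
walkEdges (step e _ p) = e ∷ walkEdges p

walkVerts : ∀ {G u v} → Walk G u v → List (Fin (nv G))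
walkVerts {u = u} []           = u ∷ []
walkVerts {u = u} (step _ _ p) = u ∷ walkVerts p

IsPath : ∀ {G u v} → Walk G u v → Set
IsPath p = Unique (walkVerts p)

Reach : (G : Graph) → (Fin (ne G) → Set) → Fin (nv G) → Fin (nv G) → Set
Reach G P u v = Σ (Walk G u v) λ p → All P (walkEdges p)

ReachWithout : (G : Graph) → Fin (ne G) → Fin (nv G) → Fin (nv G) → Set
ReachWithout G e = Reach G (λ e' → e' ≢ e)

ReachAvoiding : (G : Graph) → Subset (ne G) → Fin (nv G) → Fin (nv G) → Set
ReachAvoiding G E = Reach G (λ e' → e' ∉ E)

record IsTree (G : Graph) : Set where
  field
    connected : ∀ u v → Reach G (λ _ → ⊤) u v
    bridges   : ∀ e → ¬ ReachWithout G e (proj₁ (ends G e)) (proj₂ (ends G e))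

IsLeaf : (G : Graph) → Fin (nv G) → Set
IsLeaf G v = ∃ λ e → Incident G e v × (∀ e' → Incident G e' v → e' ≡ e)

record WeakXTree (n : ℕ) : Set where
  field
    graph  : Graph
    φ      : Fin n → Fin (nv graph)
    isTree : IsTree graph
    leavesLabelled : ∀ v → IsLeaf graph v → ∃ λ x → φ x ≡ v
open WeakXTree public

-- σ_e = A|(X-A): with (a , b) the ends of e and W the vertex set of the
-- component of T - e containing a, φ⁻¹(W) equals A or X - A.
EdgeSplitIs : ∀ {n} (T : WeakXTree n) → Fin (ne (graph T)) → Subset n → Set
EdgeSplitIs T e A =
    (∀ x → (x ∈ A → ReachWithout (graph T) e a (φ T x))
         × (ReachWithout (graph T) e a (φ T x) → x ∈ A))
  ⊎ (∀ x → (x ∉ A → ReachWithout (graph T) e a (φ T x))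
         × (ReachWithout (graph T) e a (φ T x) → x ∉ A))
  where a = proj₁ (ends (graph T) e)

-- Σ(T) = Σ_Π as multisets: a bijection between edges and entries of Σ_Π
-- respecting the splits.
RealisesSplits : ∀ {n} → WeakXTree n → PartitionSystem n → Set
RealisesSplits T Π =
  Σ (Fin (ne (graph T)) ⤖ SplitIx Π) λ β →
    ∀ e → EdgeSplitIs T e (splitSide Π (Bijection.to β e))

-- E displays π : a bijection ξ : π → E with σ_{ξ(A)} = A|(X-A).
Displays : ∀ {n} (T : WeakXTree n) → List (Subset n) → Subset (ne (graph T)) → Set
Displays T π E =
  Σ (Fin (length π) → Fin (ne (graph T))) λ ξ →
      (∀ i j → ξ i ≡ ξ j → i ≡ j)
    × (∀ i → ξ i ∈ E)
    × (∀ e → e ∈ E → ∃ λ i → ξ i ≡ e)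
    × (∀ i → EdgeSplitIs T (ξ i) (lookup π i))

countIn : ∀ {G u v} → Subset (ne G) → Walk G u v → ℕ
countIn E p = length (filter (_∈? E) (walkEdges p))

-- Conclusion (i): the components of T - E are V_0,…,V_|π| (given by a
-- surjective labelling c whose fibres are exactly the components), and
-- {φ⁻¹(V_j)} = π ∪ {∅} as sets.
ComponentsClaim : ∀ {n} (T : WeakXTree n) → List (Subset n) → Subset (ne (graph T)) → Set
ComponentsClaim T π E =
  Σ (Fin (nv (graph T)) → Fin (suc (length π))) λ c →
      (∀ j → ∃ λ v → c v ≡ j)
    × (∀ u v → (c u ≡ c v → ReachAvoiding (graph T) E u v)
             × (ReachAvoiding (graph T) E u v → c u ≡ c v))
    × (∀ j → (∀ x → c (φ T x) ≢ j)
           ⊎ (∃ λ k → ∀ x → (c (φ T x) ≡ j → x ∈ lookup π k)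
                          × (x ∈ lookup π k → c (φ T x) ≡ j)))
    × (∀ k → ∃ λ j → ∀ x → (c (φ T x) ≡ j → x ∈ lookup π k)
                         × (x ∈ lookup π k → c (φ T x) ≡ j))
    × (∃ λ j → ∀ x → c (φ T x) ≢ j)

PathClaim : ∀ {n} (T : WeakXTree n) → Subset (ne (graph T)) → Set
PathClaim T E =
  ∀ x y (p : Walk (graph T) (φ T x) (φ T y)) → IsPath p →
    countIn E p ≡ 0 ⊎ countIn E p ≡ 2

-- In a tree every edge e cuts the vertices into two sides; `side e v` records
-- on which side v lies.  Everything is derived from three facts about sides:
-- two vertices are joined in T − E iff they lie on the same side of every edge
-- of E; a path crosses e once if its ends are separated by e and never
-- otherwise (parity plus uniqueness of vertices); and two distinct edges are
-- nested.  For the edges ξ k displaying the parts A_k we normalise sides to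
-- the bit `inside k v` (v lies on the A_k-side of ξ k), so every vertex gets a
-- vector in Bool^|π|.  Labels of A_i get the indicator vector of i, and by
-- nestedness all non-indicator vectors coincide; the component of v is thus
-- i + 1 if its vector indicates i and 0 otherwise, which gives (i).  For (ii)
-- a path from A_i to A_j crosses ξ k iff k is exactly one of i, j.
module Submission where

open import Data.Bool using (Bool; true; false; not; _xor_)
open import Data.Bool.Properties
  using (xor-same; not-distribˡ-xor; not-distribʳ-xor; not-injective; not-involutive; not-¬; ¬-not)
  renaming (_≟_ to _≟ᵇ_)
open import Data.Empty using (⊥; ⊥-elim)
open import Data.Fin using (Fin; fromℕ<; _≟_) renaming (zero to fzero; suc to fsuc)
open import Data.Fin.Properties using (any?; all?; ¬∀⟶∃¬)
open import Data.Fin.Subset using (Subset; _∈_; _∉_)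
open import Data.Fin.Subset.Properties using (_∈?_; x∈p∩q⁺)
open import Data.List using (List; []; _∷_; length; lookup; filter)
open import Data.List.Relation.Unary.All as All using (All; []; _∷_)
import Data.List.Relation.Unary.AllPairs as AllPairs
open import Data.Nat using (ℕ; zero; suc; _+_; _≤_; _<_; z≤n; s≤s)
open import Data.Nat.Properties using (≤-refl; ≤-reflexive; ≤-trans; <⇒≤; m≤n⇒m≤1+n; +-suc)
open import Data.Product using (Σ; ∃; _×_; _,_; proj₁; proj₂)
open import Data.Sum using (_⊎_; inj₁; inj₂; [_,_]′)
open import Data.Unit using (tt)
open import Defs
open import Relation.Binary.PropositionalEquality
open import Relation.Nullary using (¬_; yes; no; Dec)
open import Relation.Nullary.Decidable using (_×-dec_; _→-dec_; ¬?; decidable-stable)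

true≢false : true ≢ false
true≢false ()

odd : ℕ → Bool
odd zero    = false
odd (suc n) = not (odd n)

≤1-even : ∀ {n} → n ≤ 1 → odd n ≡ false → n ≡ 0
≤1-even {zero}        _         _  = refl
≤1-even {suc zero}    _         ()
≤1-even {suc (suc _)} (s≤s ()) _

≤1-odd : ∀ {n} → n ≤ 1 → odd n ≡ true → n ≡ 1
≤1-odd {zero}        _         ()
≤1-odd {suc zero}    _         _ = refl
≤1-odd {suc (suc _)} (s≤s ()) _

xor-≢ : ∀ {a b} → a ≢ b → a xor b ≡ true
xor-≢ {false} {false} a≢b = ⊥-elim (a≢b refl)
xor-≢ {false} {true}  _   = refl
xor-≢ {true}  {false} _   = refl
xor-≢ {true}  {true}  a≢b = ⊥-elim (a≢b refl)

xor-cancelˡ : ∀ c {a b} → c xor a ≡ c xor b → a ≡ b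
xor-cancelˡ false eq = eq
xor-cancelˡ true  eq = not-injective eq

uses : ∀ {m} → Fin m → List (Fin m) → ℕ
uses e []      = 0
uses e (f ∷ l) with f ≟ e
... | yes _ = suc (uses e l)
... | no  _ = uses e l

uses-head : ∀ {m} (f : Fin m) l → uses f (f ∷ l) ≢ 0
uses-head f l with f ≟ f
... | yes _   = λ ()
... | no f≢f = ⊥-elim (f≢f refl)

uses-tail : ∀ {m} (g f : Fin m) l → uses g (f ∷ l) ≡ 0 → uses g l ≡ 0
uses-tail g f l eq with f ≟ g
uses-tail g f l () | yes _
uses-tail g f l eq | no _ = eq

∉⇒≢ : ∀ {m} {E : Subset m} {f e} → f ∉ E → e ∈ E → f ≢ e
∉⇒≢ {E = E} f∉E e∈E refl = f∉E e∈E

countE-none : ∀ {m} (E : Subset m) l → (∀ f → f ∈ E → uses f l ≡ 0) →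
              length (filter (_∈? E) l) ≡ 0
countE-none E []      _      = refl
countE-none E (f ∷ l) unused with f ∈? E
... | yes f∈E = ⊥-elim (uses-head f l (unused f f∈E))
... | no  _   = countE-none E l (λ g g∈E → uses-tail g f l (unused g g∈E))

countE-pair : ∀ {m} (E : Subset m) {a b} → a ∈ E → b ∈ E → a ≢ b → ∀ l →
              (∀ f → f ∈ E → f ≢ a → f ≢ b → uses f l ≡ 0) →
              length (filter (_∈? E) l) ≡ uses a l + uses b l
countE-pair E a∈E b∈E a≢b []      _    = refl
countE-pair E {a} {b} a∈E b∈E a≢b (f ∷ l) only =
  extend (countE-pair E a∈E b∈E a≢b l (λ g g∈E g≢a g≢b → uses-tail g f l (only g g∈E g≢a g≢b)))
  where
  extend : length (filter (_∈? E) l) ≡ uses a l + uses b l →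
           length (filter (_∈? E) (f ∷ l)) ≡ uses a (f ∷ l) + uses b (f ∷ l)
  extend ih with f ∈? E | f ≟ a | f ≟ b
  ... | no f∉E  | yes refl | _        = ⊥-elim (f∉E a∈E)
  ... | no f∉E  | no _     | yes refl = ⊥-elim (f∉E b∈E)
  ... | no _    | no _     | no _     = ih
  ... | yes _   | yes refl | yes refl = ⊥-elim (a≢b refl)
  ... | yes _   | yes refl | no _     = cong suc ih
  ... | yes _   | no _     | yes refl = trans (cong suc ih) (sym (+-suc (uses a l) (uses b l)))
  ... | yes f∈E | no f≢a   | no f≢b   = ⊥-elim (uses-head f l (only f f∈E f≢a f≢b))

module Walks (G : Graph) where

  src : Fin (ne G) → Fin (nv G)
  src e = proj₁ (ends G e)

  tgt : Fin (ne G) → Fin (nv G)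
  tgt e = proj₂ (ends G e)

  steps : ∀ {u v} → Walk G u v → ℕ
  steps []           = 0
  steps (step _ _ p) = suc (steps p)

  adj-sym : ∀ {e u w} → Adj G e u w → Adj G e w u
  adj-sym (inj₁ eq) = inj₂ eq
  adj-sym (inj₂ eq) = inj₁ eq

  adj-ends : ∀ {e u w} → Adj G e u w → (u ≡ src e × w ≡ tgt e) ⊎ (u ≡ tgt e × w ≡ src e)
  adj-ends (inj₁ eq) = inj₁ (sym (cong proj₁ eq) , sym (cong proj₂ eq))
  adj-ends (inj₂ eq) = inj₂ (sym (cong proj₂ eq) , sym (cong proj₁ eq))

  adj-same-edge : ∀ {e u w y y'} → Adj G e u w → Adj G e y y' →
                  (y ≡ u × y' ≡ w) ⊎ (y ≡ w × y' ≡ u)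
  adj-same-edge a a' with adj-ends a | adj-ends a'
  ... | inj₁ (refl , refl) | inj₁ (refl , refl) = inj₁ (refl , refl)
  ... | inj₁ (refl , refl) | inj₂ (refl , refl) = inj₂ (refl , refl)
  ... | inj₂ (refl , refl) | inj₁ (refl , refl) = inj₂ (refl , refl)
  ... | inj₂ (refl , refl) | inj₂ (refl , refl) = inj₁ (refl , refl)

  reach-refl : ∀ {P : Fin (ne G) → Set} {u} → Reach G P u u
  reach-refl = [] , []

  reach-cons : ∀ {P : Fin (ne G) → Set} {e u w v} → P e → Adj G e u w → Reach G P w v → Reach G P u v
  reach-cons pe a (p , ps) = step _ a p , pe ∷ ps

  reach-trans : ∀ {P : Fin (ne G) → Set} {u v w} → Reach G P u v → Reach G P v w → Reach G P u w
  reach-trans ([] , [])             r = r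
  reach-trans (step e a p , pe ∷ ps) r = reach-cons pe a (reach-trans (p , ps) r)

  reach-sym : ∀ {P : Fin (ne G) → Set} {u v} → Reach G P u v → Reach G P v u
  reach-sym ([] , [])             = reach-refl
  reach-sym (step e a p , pe ∷ ps) = reach-trans (reach-sym (p , ps)) (reach-cons pe (adj-sym a) reach-refl)

  reach-map : ∀ {P Q : Fin (ne G) → Set} → (∀ {f} → P f → Q f) → ∀ {u v} → Reach G P u v → Reach G Q u v
  reach-map h (p , ps) = p , All.map h ps

  data FirstUse (P : Fin (ne G) → Set) (e : Fin (ne G)) {u v : Fin (nv G)} (p : Walk G u v) : Set where
    unused : All (_≢ e) (walkEdges p) → FirstUse P e p
    used   : ∀ {y y'} → Reach G (λ f → P f × f ≢ e) u y → Adj G e y y' →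
             (rest : Walk G y' v) → steps rest < steps p → FirstUse P e p

  firstUse : ∀ {P : Fin (ne G) → Set} e {u v} (p : Walk G u v) → All P (walkEdges p) → FirstUse P e p
  firstUse e []           []        = unused []
  firstUse e (step f a p) (pf ∷ ps) with f ≟ e
  ... | yes refl = used reach-refl a p ≤-refl
  ... | no f≢e with firstUse e p ps
  ...   | unused qs          = unused (f≢e ∷ qs)
  ...   | used r a' rest lt = used (reach-cons (pf , f≢e) a r) a' rest (m≤n⇒m≤1+n lt)

  startAll : ∀ {Q : Fin (nv G) → Set} {w v} (q : Walk G w v) → All Q (walkVerts q) → Q w
  startAll []           (qw ∷ _) = qw
  startAll (step _ _ _) (qw ∷ _) = qw

  avoidVertex⇒unusedIncident : ∀ {e u w v} (q : Walk G w v) → All (u ≢_) (walkVerts q) →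
                               Incident G e u → uses e (walkEdges q) ≡ 0
  avoidVertex⇒unusedIncident []           _            _   = refl
  avoidVertex⇒unusedIncident {e} (step f a q) (u≢w ∷ avoid) inc with f ≟ e
  ... | no _ = avoidVertex⇒unusedIncident q avoid inc
  ... | yes refl with adj-ends a | inc
  ...   | inj₁ (refl , refl) | inj₁ refl = ⊥-elim (u≢w refl)
  ...   | inj₁ (refl , refl) | inj₂ refl = ⊥-elim (startAll q avoid refl)
  ...   | inj₂ (refl , refl) | inj₁ refl = ⊥-elim (startAll q avoid refl)
  ...   | inj₂ (refl , refl) | inj₂ refl = ⊥-elim (u≢w refl)

  path-uses≤1 : ∀ e {u v} (p : Walk G u v) → IsPath p → uses e (walkEdges p) ≤ 1
  path-uses≤1 e []           _                      = z≤n
  path-uses≤1 e (step f a p) (u∉p AllPairs.∷ isPath) with f ≟ e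
  ... | no _ = path-uses≤1 e p isPath
  ... | yes refl with adj-ends a
  ...   | inj₁ (u≡src , _) = ≤-reflexive (cong suc (avoidVertex⇒unusedIncident p u∉p (inj₁ (sym u≡src))))
  ...   | inj₂ (u≡tgt , _) = ≤-reflexive (cong suc (avoidVertex⇒unusedIncident p u∉p (inj₂ (sym u≡tgt))))

module Sides (G : Graph) (tree : IsTree G) where
  open Walks G
  open IsTree tree

  nearEnd : ∀ e v → ReachWithout G e v (src e) ⊎ ReachWithout G e v (tgt e)
  nearEnd e v with connected v (src e)
  ... | p , ps with firstUse e p ps
  ...   | unused qs = inj₁ (p , qs)
  ...   | used r a _ _ with adj-ends a
  ...     | inj₁ (refl , _) = inj₁ (reach-map proj₂ r)
  ...     | inj₂ (refl , _) = inj₂ (reach-map proj₂ r)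

  notBothEnds : ∀ {e v} → ReachWithout G e v (src e) → ReachWithout G e v (tgt e) → ⊥
  notBothEnds {e} rs rt = bridges e (reach-trans (reach-sym rs) rt)

  -- side e v is false on the component of T − e containing src e, true on the other.
  side : Fin (ne G) → Fin (nv G) → Bool
  side e v with nearEnd e v
  ... | inj₁ _ = false
  ... | inj₂ _ = true

  side-src : ∀ {e v} → ReachWithout G e v (src e) → side e v ≡ false
  side-src {e} {v} rs with nearEnd e v
  ... | inj₁ _  = refl
  ... | inj₂ rt = ⊥-elim (notBothEnds rs rt)

  side-tgt : ∀ {e v} → ReachWithout G e v (tgt e) → side e v ≡ true
  side-tgt {e} {v} rt with nearEnd e v
  ... | inj₁ rs = ⊥-elim (notBothEnds rs rt)
  ... | inj₂ _  = refl

  side≡false : ∀ {e v} → side e v ≡ false → ReachWithout G e v (src e)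
  side≡false {e} {v} eq with nearEnd e v
  side≡false         _  | inj₁ rs = rs
  side≡false         () | inj₂ _

  side≡true : ∀ {e v} → side e v ≡ true → ReachWithout G e v (tgt e)
  side≡true {e} {v} eq with nearEnd e v
  side≡true         () | inj₁ _
  side≡true         _  | inj₂ rt = rt

  side-reach : ∀ {e u v} → ReachWithout G e u v → side e u ≡ side e v
  side-reach {e} {u} {v} r with side e v in eq
  ... | false = side-src (reach-trans r (side≡false eq))
  ... | true  = side-tgt (reach-trans r (side≡true eq))

  side-cross : ∀ {e u w} → Adj G e u w → side e u ≡ not (side e w)
  side-cross a with adj-ends a
  ... | inj₁ (refl , refl) = trans (side-src reach-refl) (sym (cong not (side-tgt reach-refl)))
  ... | inj₂ (refl , refl) = trans (side-tgt reach-refl) (sym (cong not (side-src reach-refl)))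

  side-adj : ∀ {e f u w} → Adj G f u w → f ≢ e → side e u ≡ side e w
  side-adj a f≢e = side-reach (reach-cons f≢e a reach-refl)

  side-ends : ∀ {e f} → f ≢ e → side e (src f) ≡ side e (tgt f)
  side-ends {f = f} = side-adj {f = f} (inj₁ refl)

  -- Distinct edges are nested: a vertex separated from f by e lies on the
  -- same side of f as e does.
  nested : ∀ {e f} → f ≢ e → ∀ v → side e v ≢ side e (src f) → side f v ≡ side f (src e)
  nested {e} {f} f≢e v v≁f =
    [ (λ r → via r refl) , (λ r → via r (sym (side-ends (≢-sym f≢e)))) ]′ (nearEnd e v)
    where
    endpoint : ∀ {y y'} → Adj G f y y' → side e y ≡ side e (src f)
    endpoint a with adj-ends a
    ... | inj₁ (refl , _) = refl
    ... | inj₂ (refl , _) = sym (side-ends f≢e)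

    -- so a walk from v avoiding e never reaches f
    via : ∀ {z} → ReachWithout G e v z → side f z ≡ side f (src e) → side f v ≡ side f (src e)
    via (p , ps) z≈e with firstUse f p ps
    ... | unused qs    = trans (side-reach (p , qs)) z≈e
    ... | used r a _ _ = ⊥-elim (v≁f (trans (side-reach (reach-map proj₁ r)) (endpoint a)))

  parity : ∀ e {u v} (p : Walk G u v) → side e u xor side e v ≡ odd (uses e (walkEdges p))
  parity e []                    = xor-same (side e _)
  parity e {u} {v} (step {w = w} f a p) with f ≟ e
  ... | no f≢e = trans (cong (_xor side e v) (side-adj a f≢e)) (parity e p)
  ... | yes refl = begin
      side e u xor side e v         ≡⟨ cong (_xor side e v) (side-cross a) ⟩
      not (side e w) xor side e v   ≡⟨ sym (not-distribˡ-xor (side e w) (side e v)) ⟩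
      not (side e w xor side e v)   ≡⟨ cong not (parity e p) ⟩
      not (odd (uses e (walkEdges p))) ∎
    where open ≡-Reasoning

  path-avoids : ∀ e {u v} (p : Walk G u v) → IsPath p → side e u ≡ side e v → uses e (walkEdges p) ≡ 0
  path-avoids e {u} {v} p isPath same =
    ≤1-even (path-uses≤1 e p isPath)
            (trans (sym (parity e p)) (trans (cong (_xor side e v) same) (xor-same (side e v))))

  path-crosses : ∀ e {u v} (p : Walk G u v) → IsPath p → side e u ≢ side e v → uses e (walkEdges p) ≡ 1
  path-crosses e p isPath separated =
    ≤1-odd (path-uses≤1 e p isPath) (trans (sym (parity e p)) (xor-≢ separated))

  reachAvoiding⇒sameSides : ∀ {E u v} → ReachAvoiding G E u v → ∀ e → e ∈ E → side e u ≡ side e v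
  reachAvoiding⇒sameSides r e e∈E = side-reach (reach-map (λ f∉E → ∉⇒≢ f∉E e∈E) r)

  -- ... and conversely.  A walk from u to v that enters an edge f ∈ E must
  -- cross f back to u later (v lies on u's side of f); we drop that detour.
  sameSides⇒reachAvoiding : ∀ E {u v} → (∀ e → e ∈ E → side e u ≡ side e v) → ReachAvoiding G E u v
  sameSides⇒reachAvoiding E {u} {v} same = shorten _ (proj₁ (connected u v)) ≤-refl same
    where
    shorten : ∀ N {u} (p : Walk G u v) → steps p ≤ N →
              (∀ e → e ∈ E → side e u ≡ side e v) → ReachAvoiding G E u v
    shorten _       []           _         _     = reach-refl
    shorten (suc N) (step f a q) (s≤s len) same with f ∈? E
    ... | no f∉E = reach-cons f∉E a
                     (shorten N q len (λ e e∈E → trans (sym (side-adj a (∉⇒≢ f∉E e∈E))) (same e e∈E)))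
    ... | yes f∈E with firstUse f q (All.tabulate (λ _ → tt))
    ...   | unused qs = ⊥-elim (not-¬ refl
              (trans (side-cross a) (cong not (trans (side-reach (q , qs)) (sym (same f f∈E))))))
    ...   | used r a' rest shorter with adj-same-edge a a'
    ...     | inj₁ (refl , _) = ⊥-elim (not-¬ refl
                (trans (side-cross a) (cong not (side-reach (reach-map proj₂ r)))))
    ...     | inj₂ (_ , refl) = shorten N rest (≤-trans (<⇒≤ shorter) len) same

module Labelled {n} (T : WeakXTree n) where
  open Walks (graph T) using (reach-sym)
  open Sides (graph T) (isTree T)

  labelsOnSide : ∀ {e A} → EdgeSplitIs T e A →
    Σ Bool λ b → ∀ x → (x ∈ A → b xor side e (φ T x) ≡ true) × (b xor side e (φ T x) ≡ true → x ∈ A)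
  labelsOnSide {e} {A} (inj₁ srcSide) = true , λ x →
      (λ x∈A → cong not (side-src (reach-sym (proj₁ (srcSide x) x∈A))))
    , (λ notSide → proj₂ (srcSide x) (reach-sym
                     (side≡false (trans (sym (not-involutive _)) (cong not notSide)))))
  labelsOnSide {e} {A} (inj₂ srcSide) = false , λ x →
      (λ x∈A → ¬-not (λ onSrc → proj₂ (srcSide x) (reach-sym (side≡false onSrc)) x∈A))
    , (λ onTgt → decidable-stable (x ∈? A) (λ x∉A →
         true≢false (trans (sym onTgt) (side-src (reach-sym (proj₁ (srcSide x) x∉A))))))

module Indicator {L : ℕ} where

  IsIndicator : (Fin L → Bool) → Fin L → Set
  IsIndicator f i = f i ≡ true × (∀ m → m ≢ i → f m ≡ false)

  NoIndicator : (Fin L → Bool) → Set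
  NoIndicator f = ∀ i → ¬ IsIndicator f i

  TwoTrue : (Fin L → Bool) → Set
  TwoTrue f = Σ (Fin L) λ k → Σ (Fin L) λ m → k ≢ m × f k ≡ true × f m ≡ true

  indicator? : ∀ f → Dec (∃ (IsIndicator f))
  indicator? f = any? (λ i → (f i ≟ᵇ true) ×-dec all? (λ m → ¬? (m ≟ i) →-dec (f m ≟ᵇ false)))

  indicator-unique : ∀ {f i j} → IsIndicator f i → IsIndicator f j → i ≡ j
  indicator-unique {i = i} {j} (fi , _) (_ , others) with i ≟ j
  ... | yes i≡j = i≡j
  ... | no  i≢j = ⊥-elim (true≢false (trans (sym fi) (others i i≢j)))

  indicator-ext : ∀ {f g i} → (∀ k → f k ≡ g k) → IsIndicator f i → IsIndicator g i
  indicator-ext f≈g (fi , others) = trans (sym (f≈g _)) fi , λ m m≢i → trans (sym (f≈g m)) (others m m≢i)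

  indicator-agree : ∀ {f g i} → IsIndicator f i → IsIndicator g i → ∀ k → f k ≡ g k
  indicator-agree {i = i} (fi , fo) (gi , go) k with k ≟ i
  ... | yes refl = trans fi (sym gi)
  ... | no  k≢i  = trans (fo k k≢i) (sym (go k k≢i))

  twoTrue⇒noIndicator : ∀ {f} → TwoTrue f → NoIndicator f
  twoTrue⇒noIndicator (k , m , k≢m , fk , fm) i (_ , others) with k ≟ i
  ... | yes refl = true≢false (trans (sym fm) (others m (≢-sym k≢m)))
  ... | no  k≢i  = true≢false (trans (sym fk) (others k k≢i))

  noIndicator-cases : ∀ {f} → NoIndicator f → (∀ k → f k ≡ false) ⊎ TwoTrue f
  noIndicator-cases {f} none with all? (λ k → f k ≟ᵇ false)
  ... | yes allFalse = inj₁ allFalse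
  ... | no  notAll with ¬∀⟶∃¬ L _ (λ k → f k ≟ᵇ false) notAll
  ...   | k , fk≢false with ¬∀⟶∃¬ L (λ m → m ≢ k → f m ≡ false)
                            (λ m → ¬? (m ≟ k) →-dec (f m ≟ᵇ false))
                            (λ others → none k (¬-not fk≢false , others))
  ...     | m , ¬[m≢k→fm≡false] =
    inj₂ (k , m , (λ k≡m → ¬[m≢k→fm≡false] (λ m≢k → ⊥-elim (m≢k (sym k≡m))))
         , ¬-not fk≢false , ¬-not (λ fm≡false → ¬[m≢k→fm≡false] (λ _ → fm≡false)))

  position : (Fin L → Bool) → Fin (suc L)
  position f with indicator? f
  ... | yes (i , _) = fsuc i
  ... | no  _       = fzero

  position-indicator : ∀ {f i} → IsIndicator f i → position f ≡ fsuc i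
  position-indicator {f} ind with indicator? f
  ... | yes (j , ind') = cong fsuc (indicator-unique ind' ind)
  ... | no  none       = ⊥-elim (none (_ , ind))

  position-none : ∀ {f} → NoIndicator f → position f ≡ fzero
  position-none {f} none with indicator? f
  ... | yes (j , ind) = ⊥-elim (none j ind)
  ... | no  _         = refl

  position≡suc : ∀ {f i} → position f ≡ fsuc i → IsIndicator f i
  position≡suc {f} eq with indicator? f
  position≡suc     refl | yes (_ , ind) = ind
  position≡suc     ()   | no  _

  position≡zero : ∀ {f} → position f ≡ fzero → NoIndicator f
  position≡zero {f} eq with indicator? f
  position≡zero     () | yes _
  position≡zero     _  | no  none = λ i ind → none (i , ind)

  position-ext : ∀ {f g} → (∀ k → f k ≡ g k) → position f ≡ position g
  position-ext {f} {g} f≈g with indicator? f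
  ... | yes (i , ind) = sym (position-indicator (indicator-ext f≈g ind))
  ... | no  none      = sym (position-none (λ i ind → none (i , indicator-ext (λ k → sym (f≈g k)) ind)))

module DisplayedPartition {n} (T : WeakXTree n) (π : List (Subset n)) (isP : IsPartition π)
                          (E : Subset (ne (graph T))) (disp : Displays T π E) where
  open Walks (graph T)
  open Sides (graph T) (isTree T)
  open Labelled T
  open Indicator
  open IsPartition isP

  L : ℕ
  L = length π

  part : Fin L → Subset n
  part = lookup π

  ξ : Fin L → Fin (ne (graph T))
  ξ = proj₁ disp

  ξ-distinct : ∀ {k m} → k ≢ m → ξ k ≢ ξ m
  ξ-distinct k≢m eq = k≢m (proj₁ (proj₂ disp) _ _ eq)

  ξ∈E : ∀ k → ξ k ∈ E
  ξ∈E = proj₁ (proj₂ (proj₂ disp))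

  ξ-onto : ∀ e → e ∈ E → ∃ λ k → ξ k ≡ e
  ξ-onto = proj₁ (proj₂ (proj₂ (proj₂ disp)))

  samePart : ∀ {x i j} → x ∈ part i → x ∈ part j → i ≡ j
  samePart {x} {i} {j} x∈i x∈j with i ≟ j
  ... | yes i≡j = i≡j
  ... | no  i≢j = ⊥-elim (disjoint i j i≢j (x , x∈p∩q⁺ (x∈i , x∈j)))

  splits : ∀ k → EdgeSplitIs T (ξ k) (part k)
  splits = proj₂ (proj₂ (proj₂ (proj₂ disp)))

  -- the side of ξ k not containing the labels of part k
  far : Fin L → Bool
  far k = proj₁ (labelsOnSide (splits k))

  -- inside k v: v lies on the side of ξ k that contains the labels of part k.
  inside : Fin L → Fin (nv (graph T)) → Bool
  inside k v = far k xor side (ξ k) v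

  inside-label : ∀ {k x} → x ∈ part k → inside k (φ T x) ≡ true
  inside-label {k} {x} = proj₁ (proj₂ (labelsOnSide (splits k)) x)

  inside-label⁻¹ : ∀ {k x} → inside k (φ T x) ≡ true → x ∈ part k
  inside-label⁻¹ {k} {x} = proj₂ (proj₂ (labelsOnSide (splits k)) x)

  outside-label : ∀ {k x} → x ∉ part k → inside k (φ T x) ≡ false
  outside-label x∉k = ¬-not (λ inK → x∉k (inside-label⁻¹ inK))

  inside-cross : ∀ {k u w} → Adj (graph T) (ξ k) u w → inside k u ≡ not (inside k w)
  inside-cross {k} {u} {w} a =
    trans (cong (far k xor_) (side-cross a)) (sym (not-distribʳ-xor (far k) (side (ξ k) w)))

  inside-adj : ∀ {k f u w} → Adj (graph T) f u w → f ≢ ξ k → inside k u ≡ inside k w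
  inside-adj {k} a f≢ξk = cong (far k xor_) (side-adj a f≢ξk)

  inside-nested : ∀ {k m} → k ≢ m → ∀ v → inside k v ≢ inside k (src (ξ m)) →
                  inside m v ≡ inside m (src (ξ k))
  inside-nested {k} {m} k≢m v v≁ =
    cong (far m xor_) (nested (ξ-distinct (≢-sym k≢m)) v (λ eq → v≁ (cong (far k xor_) eq)))

  -- If the part-sides of distinct k and m overlap, they cover all vertices
  -- (nestedness leaves only this or disjointness; the latter contradicts the
  -- overlap, via the labels of part k).
  overlap⇒cover : ∀ {k m u} → k ≢ m → inside k u ≡ true → inside m u ≡ true →
                  ∀ v → inside k v ≡ true ⊎ inside m v ≡ true
  overlap⇒cover {k} {m} {u} k≢m ku mu with inside k (src (ξ m)) in ks
  ... | false = ⊥-elim (k≢m (samePart y∈k y∈m))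
    where
    -- ξ m lies off the k-side, so u and the labels of part k both lie on ξ k's side of ξ m
    y : Fin n
    y = proj₁ (nonempty k)
    y∈k : y ∈ part k
    y∈k = proj₂ (nonempty k)
    m-at-ξk : inside m (src (ξ k)) ≡ true
    m-at-ξk = trans (sym (inside-nested k≢m u (λ eq → true≢false (trans (sym ku) (trans eq ks))))) mu
    y∈m : y ∈ part m
    y∈m = inside-label⁻¹ (trans (inside-nested k≢m (φ T y)
            (λ eq → true≢false (trans (sym (inside-label y∈k)) (trans eq ks)))) m-at-ξk)
  ... | true = cover
    where
    -- ξ m lies on the k-side, so everything off the k-side lies on ξ k's side of ξ m,
    -- as do the labels of part m
    x : Fin n
    x = proj₁ (nonempty m)
    x∈m : x ∈ part m
    x∈m = proj₂ (nonempty m)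
    m-at-ξk : inside m (src (ξ k)) ≡ true
    m-at-ξk = trans (sym (inside-nested k≢m (φ T x) (λ eq → true≢false
                (sym (trans (sym (outside-label (λ x∈k → k≢m (samePart x∈k x∈m)))) (trans eq ks))))))
              (inside-label x∈m)
    cover : ∀ v → inside k v ≡ true ⊎ inside m v ≡ true
    cover v with inside k v in kv
    ... | true  = inj₁ refl
    ... | false = inj₂ (trans (inside-nested k≢m v
                    (λ eq → true≢false (sym (trans (sym kv) (trans eq ks))))) m-at-ξk)

  vector : Fin (nv (graph T)) → Fin L → Bool
  vector v k = inside k v

  -- Two true entries force every entry to be true: every part meets one of
  -- the two covering sides.
  twoTrue⇒allTrue : ∀ {v} → TwoTrue (vector v) → ∀ l → inside l v ≡ true
  twoTrue⇒allTrue {v} (k , m , k≢m , kv , mv) l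
    with overlap⇒cover k≢m kv mv (φ T (proj₁ (nonempty l)))
  ... | inj₁ ky = subst (λ j → inside j v ≡ true) (sym (samePart (proj₂ (nonempty l)) (inside-label⁻¹ ky))) kv
  ... | inj₂ my = subst (λ j → inside j v ≡ true) (sym (samePart (proj₂ (nonempty l)) (inside-label⁻¹ my))) mv

  twoTrue⇒notAllFalse : ∀ {u v} → TwoTrue (vector u) → ¬ (∀ k → inside k v ≡ false)
  twoTrue⇒notAllFalse {v = v} (k , m , k≢m , ku , mu) allFalse with overlap⇒cover k≢m ku mu v
  ... | inj₁ kv = true≢false (trans (sym kv) (allFalse k))
  ... | inj₂ mv = true≢false (trans (sym mv) (allFalse m))

  noIndicator-agree : ∀ {u v} → NoIndicator (vector u) → NoIndicator (vector v) → ∀ k → inside k u ≡ inside k v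
  noIndicator-agree nu nv k with noIndicator-cases nu | noIndicator-cases nv
  ... | inj₁ fu | inj₁ fv = trans (fu k) (sym (fv k))
  ... | inj₁ fu | inj₂ tv = ⊥-elim (twoTrue⇒notAllFalse tv fu)
  ... | inj₂ tu | inj₁ fv = ⊥-elim (twoTrue⇒notAllFalse tu fv)
  ... | inj₂ tu | inj₂ tv = trans (twoTrue⇒allTrue tu k) (sym (twoTrue⇒allTrue tv k))

  component : Fin (nv (graph T)) → Fin (suc L)
  component v = position (vector v)

  sameComponent⇒sameVector : ∀ {u v} → component u ≡ component v → ∀ k → inside k u ≡ inside k v
  sameComponent⇒sameVector {u} {v} eq = byLabel _ eq refl
    where
    byLabel : ∀ j → component u ≡ j → component v ≡ j → ∀ k → inside k u ≡ inside k v
    byLabel fzero    cu cv = noIndicator-agree (position≡zero cu) (position≡zero cv)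
    byLabel (fsuc i) cu cv = indicator-agree (position≡suc cu) (position≡suc cv)

  -- E is exactly the image of ξ, so agreeing in all bits `inside` means lying
  -- on the same side of every edge of E.
  sameVector⇒sameSides : ∀ {u v} → (∀ k → inside k u ≡ inside k v) → ∀ e → e ∈ E → side e u ≡ side e v
  sameVector⇒sameSides same e e∈E with ξ-onto e e∈E
  ... | k , refl = xor-cancelˡ (far k) (same k)

  sameSides⇒sameVector : ∀ {u v} → (∀ e → e ∈ E → side e u ≡ side e v) → ∀ k → inside k u ≡ inside k v
  sameSides⇒sameVector same k = cong (far k xor_) (same (ξ k) (ξ∈E k))

  component⇔reach : ∀ u v → (component u ≡ component v → ReachAvoiding (graph T) E u v)
                          × (ReachAvoiding (graph T) E u v → component u ≡ component v)
  component⇔reach u v =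
      (λ eq → sameSides⇒reachAvoiding E (sameVector⇒sameSides (sameComponent⇒sameVector eq)))
    , (λ r → position-ext (sameSides⇒sameVector (reachAvoiding⇒sameSides r)))

  label-component : ∀ {x i} → x ∈ part i → component (φ T x) ≡ fsuc i
  label-component x∈i =
    position-indicator (inside-label x∈i , λ m m≢i → outside-label (λ x∈m → m≢i (samePart x∈m x∈i)))

  component-label : ∀ {x i} → component (φ T x) ≡ fsuc i → x ∈ part i
  component-label eq = inside-label⁻¹ (proj₁ (position≡suc eq))

  label-notZero : ∀ x → component (φ T x) ≢ fzero
  label-notZero x eq with () ← trans (sym (label-component (proj₂ (covers x)))) eq

  -- Component zero is nonempty: take the endpoint q of some ξ k off the side of
  -- part k; if q still lies only on the side of some part m, its neighbour across
  -- ξ k lies on the sides of both k and m.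
  zeroAcross : ∀ {k p q} → Adj (graph T) (ξ k) p q → inside k q ≡ false → ∃ λ v → component v ≡ fzero
  zeroAcross {k} {p} {q} a kq with indicator? (vector q)
  ... | no none = q , position-none (λ i ind → none (i , ind))
  ... | yes (m , mq , _) = p , position-none (twoTrue⇒noIndicator (k , m , k≢m , kp , mp))
    where
    k≢m : k ≢ m
    k≢m refl = true≢false (trans (sym mq) kq)
    kp : inside k p ≡ true
    kp = trans (inside-cross a) (cong not kq)
    mp : inside m p ≡ true
    mp = trans (inside-adj a (ξ-distinct k≢m)) mq

  k₀ : Fin L
  k₀ = fromℕ< (≤-trans (s≤s z≤n) atLeastTwo)

  zeroComponent : ∃ λ v → component v ≡ fzero
  zeroComponent with inside k₀ (tgt (ξ k₀)) in kt
  ... | false = zeroAcross (inj₁ refl) kt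
  ... | true  = zeroAcross (inj₂ refl) (trans (inside-cross (inj₁ refl)) (cong not kt))

  component-onto : ∀ j → ∃ λ v → component v ≡ j
  component-onto fzero    = zeroComponent
  component-onto (fsuc i) = φ T (proj₁ (nonempty i)) , label-component (proj₂ (nonempty i))

  components : ComponentsClaim T π E
  components = component , component-onto , component⇔reach
             , (λ { fzero → inj₁ label-notZero ; (fsuc k) → inj₂ (k , labels k) })
             , (λ k → fsuc k , labels k)
             , (fzero , label-notZero)
    where
    labels : ∀ k x → (component (φ T x) ≡ fsuc k → x ∈ part k) × (x ∈ part k → component (φ T x) ≡ fsuc k)
    labels k x = component-label , label-component

  separates : ∀ {k a b} → a ∈ part k → b ∉ part k → inside k (φ T a) ≢ inside k (φ T b)
  separates a∈k b∉k eq = true≢false (trans (sym (inside-label a∈k)) (trans eq (outside-label b∉k)))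

  module _ {x y} (p : Walk (graph T) (φ T x) (φ T y)) (isPath : IsPath p) where

    crossings-same : ∀ {k} → inside k (φ T x) ≡ inside k (φ T y) → uses (ξ k) (walkEdges p) ≡ 0
    crossings-same {k} same = path-avoids (ξ k) p isPath (xor-cancelˡ (far k) same)

    crossings-differ : ∀ {k} → inside k (φ T x) ≢ inside k (φ T y) → uses (ξ k) (walkEdges p) ≡ 1
    crossings-differ {k} differ = path-crosses (ξ k) p isPath (λ same → differ (cong (far k xor_) same))

    crossings-other : ∀ {i j} → x ∈ part i → y ∈ part j →
                      ∀ f → f ∈ E → f ≢ ξ i → f ≢ ξ j → uses f (walkEdges p) ≡ 0
    crossings-other x∈i y∈j f f∈E f≢ξi f≢ξj with ξ-onto f f∈E
    ... | k , refl = crossings-same (trans (outside-label (λ x∈k → f≢ξi (cong ξ (samePart x∈k x∈i))))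
                                    (sym (outside-label (λ y∈k → f≢ξj (cong ξ (samePart y∈k y∈j))))))

  pathClaim : PathClaim T E
  pathClaim x y p isPath with covers x | covers y
  ... | i , x∈i | j , y∈j with i ≟ j
  ...   | yes refl = inj₁ (countE-none E (walkEdges p) noneUsed)
    where
    noneUsed : ∀ f → f ∈ E → uses f (walkEdges p) ≡ 0
    noneUsed f f∈E with f ≟ ξ i
    ... | yes refl = crossings-same p isPath (trans (inside-label x∈i) (sym (inside-label y∈j)))
    ... | no  f≢ξi = crossings-other p isPath x∈i y∈j f f∈E f≢ξi f≢ξi
  ...   | no  i≢j = inj₂ (trans (countE-pair E (ξ∈E i) (ξ∈E j) (ξ-distinct i≢j) (walkEdges p)
                                              (crossings-other p isPath x∈i y∈j))
                                (cong₂ _+_ (crossings-differ p isPath (separates x∈i (λ y∈i → i≢j (samePart y∈i y∈j))))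
                                           (crossings-differ p isPath
                                              (≢-sym (separates y∈j (λ x∈j → i≢j (samePart x∈i x∈j)))))))

lemma3p2 : ∀ {n : ℕ} → 2 ≤ n →
    (Π : PartitionSystem n) → IsPartitionSystem Π → Compatible Π →
    (T : WeakXTree n) → RealisesSplits T Π →
    (i : Fin (length Π)) (E : Subset (ne (graph T))) →
    Displays T (lookup Π i) E →
    ComponentsClaim T (lookup Π i) E × PathClaim T E
lemma3p2 _ Π isPS _ T _ i E displays = components , pathClaim
  where open DisplayedPartition T (lookup Π i) (isPS i) E displays
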